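{- Let $D$ be a source transitive tree. Then the only identifying code of $D$ is $V(D)$.
   Context: Oriented graphs have no loops, no multiple arcs and no pair of symmetric arcs; vertex sets are finite or countably infinite. For a vertex $x$, $B_1^+(x)$ is the set consisting of $x$ and all $w$ with an arc from $w$ to $x$. An identifying code of $D$ is a set $C\subseteq V(D)$ with $B_1^+(u)\cap C\neq\emptyset$ for all $u$ and $B_1^+(u)\cap C\neq B_1^+(v)\cap C$ for all distinct $u,v$. The transitive closure of a digraph adds an arc $\overrightarrow{ab}$ whenever there is a directed path from $a$ to $b$. A connected (possibly infinite) oriented graph $D$ is an $fst$-tree if (1) for each vertex $x$, the subgraph induced by $B_1^+(x)$ is the transitive closure of a finite directed path $P_x$ with vertex set $B_1^+(x)$ ending at $x$, and (2) for each pair $x,y$ of vertices there is a vertex $z$ with $V(P_x)\cap V(P_y)=V(P_z)$. An oriented graph $D$ is an $ist$-tree if (1) for each vertex $x$, the subgraph induced by $B_1^+(x)$ is the transitive closure of an infinite directed path $P_x=\cdots x_{ -2}x_{ -1}x_0$ with $x_0=x$ and vertex set $B_1^+(x)$, and (2) for each pair $x,y$ there is a vertex $z$ with $V(P_x)\cap V(P_y)=V(P_z)$. A source transitive tree is an $fst$-tree or an $ist$-tree. -}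

module Defs where

open import Data.Nat using (ℕ; _<_)
open import Data.Fin using (Fin; toℕ)
import Data.Fin as F
open import Data.Bool using (Bool; true)
open import Data.Product using (Σ; ∃; _×_; _,_)
open import Data.Sum using (_⊎_)
open import Data.Empty using (⊥)
open import Relation.Nullary using (¬_)
open import Relation.Binary.PropositionalEquality using (_≡_)
open import Function.Bundles using (_⇔_)
open import Function.Definitions using (Injective)

record OrientedGraph : Set₁ where
  field
    V         : Set
    _⇒_       : V → V → Set
    countable : Σ (V → ℕ) λ f → Injective _≡_ _≡_ f
    noLoop    : ∀ x → ¬ (x ⇒ x)
    noSym     : ∀ x y → x ⇒ y → ¬ (y ⇒ x)

module _ (D : OrientedGraph) where
  open OrientedGraph D

  B₁⁺ : V → V → Set
  B₁⁺ x w = (w ≡ x) ⊎ (w ⇒ x)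

  data Walk : V → V → Set where
    here : ∀ {u} → Walk u u
    step : ∀ {u v w} → (u ⇒ v ⊎ v ⇒ u) → Walk v w → Walk u w

  Connected : Set
  Connected = ∀ u v → Walk u v

  _∈_ : V → (V → Bool) → Set
  w ∈ C = C w ≡ true

  IsIdentifyingCode : (V → Bool) → Set
  IsIdentifyingCode C =
    (∀ u → ∃ λ w → B₁⁺ u w × w ∈ C)
    × (∀ u v → ¬ (u ≡ v) →
         ¬ (∀ w → (B₁⁺ u w × w ∈ C) ⇔ (B₁⁺ v w × w ∈ C)))

  -- A finite directed path P_x = x_{-n} ... x_{-1} x_0 with x_0 = x, stored as
  -- i ↦ x_{-i}; the subgraph induced by B₁⁺(x) is its transitive closure.
  record FinSourcePath (x : V) : Set where
    field
      len      : ℕ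
      vtx      : Fin (Data.Nat.suc len) → V
      vtx-inj  : Injective _≡_ _≡_ vtx
      ends     : vtx F.zero ≡ x
      vset     : ∀ w → B₁⁺ x w ⇔ (∃ λ i → vtx i ≡ w)
      arcs     : ∀ i j → (vtx i ⇒ vtx j) ⇔ (toℕ j < toℕ i)

  -- An infinite directed path ... x_{-2} x_{-1} x_0 with x_0 = x, stored as
  -- i ↦ x_{-i}; the subgraph induced by B₁⁺(x) is its transitive closure.
  record InfSourcePath (x : V) : Set where
    field
      vtx      : ℕ → V
      vtx-inj  : Injective _≡_ _≡_ vtx
      ends     : vtx 0 ≡ x
      vset     : ∀ w → B₁⁺ x w ⇔ (∃ λ i → vtx i ≡ w)
      arcs     : ∀ i j → (vtx i ⇒ vtx j) ⇔ (j < i)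

  record FstTree : Set where
    field
      connected : Connected
      path      : ∀ x → FinSourcePath x
      meet      : ∀ x y → ∃ λ z → ∀ w →
        ((∃ λ i → FinSourcePath.vtx (path x) i ≡ w)
          × (∃ λ i → FinSourcePath.vtx (path y) i ≡ w))
        ⇔ (∃ λ i → FinSourcePath.vtx (path z) i ≡ w)

  record IstTree : Set where
    field
      path      : ∀ x → InfSourcePath x
      meet      : ∀ x y → ∃ λ z → ∀ w →
        ((∃ λ i → InfSourcePath.vtx (path x) i ≡ w)
          × (∃ λ i → InfSourcePath.vtx (path y) i ≡ w))
        ⇔ (∃ λ i → InfSourcePath.vtx (path z) i ≡ w)

  SourceTransitiveTree : Set
  SourceTransitiveTree = FstTree ⊎ IstTree

-- A vertex v with no in-neighbour must lie in every code, since B₁⁺(v) = {v}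
-- has to meet it. Otherwise let u be the vertex preceding v on P_v. Every
-- other vertex of P_v lies in B₁⁺(u), and the meet axiom applied to u and v
-- gives B₁⁺(u) ⊆ B₁⁺(v); hence B₁⁺(v) = B₁⁺(u) ∪ {v}, and a code avoiding v
-- could not separate u from v.
module Submission where

open import Defs
open import Data.Bool using (Bool; true; false)
open import Data.Nat using (zero; suc; s≤s; z≤n)
open import Data.Fin using (Fin)
import Data.Fin as F
open import Data.Product using (_×_; _,_; proj₁; proj₂; ∃)
open import Data.Product.Function.NonDependent.Propositional using (_×-⇔_)
open import Data.Sum using (_⊎_; inj₁; inj₂)
open import Data.Empty using (⊥-elim)
open import Relation.Nullary using (¬_; contradiction)
open import Relation.Binary.PropositionalEquality using (_≡_; _≢_; refl; sym; trans; subst)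
open import Function.Bundles using (_⇔_; mk⇔; Equivalence)
open import Function.Construct.Composition using (_⇔-∘_)
open import Function.Construct.Symmetry using (⇔-sym)

module _ (D : OrientedGraph) where
  open OrientedGraph D
  open Equivalence

  private
    B : V → V → Set
    B = B₁⁺ D

  arc⇒≢ : ∀ {u v} → u ⇒ v → u ≢ v
  arc⇒≢ {v = v} uv refl = noLoop v uv

  Source : V → Set
  Source v = ∀ w → B v w → w ≡ v

  Parent : V → V → Set
  Parent u v = u ⇒ v × (∀ w → B v w → w ≢ v → B u w)

  BallsClosedUnderMeet : Set
  BallsClosedUnderMeet = ∀ x y → ∃ λ z → ∀ w → (B x w × B y w) ⇔ B z w

  ballsClosedUnderMeet-transport : (P : V → V → Set) → (∀ x w → B x w ⇔ P x w) →
    (∀ x y → ∃ λ z → ∀ w → (P x w × P y w) ⇔ P z w) → BallsClosedUnderMeet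
  ballsClosedUnderMeet-transport P B⇔P meetP x y with meetP x y
  ... | z , meet = z , λ w → ⇔-sym (B⇔P z w) ⇔-∘ (meet w ⇔-∘ (B⇔P x w ×-⇔ B⇔P y w))

  -- The meet z of u and v contains u and lies in B₁⁺(u), so z = u.
  arc⇒ball-⊆ : BallsClosedUnderMeet → ∀ {u v} → u ⇒ v → ∀ w → B u w → B v w
  arc⇒ball-⊆ meets {u} {v} uv w uw with meets u v
  ... | z , meet = proj₂ (from (meet w) (subst (λ t → B t w) (sym z≡u) uw))
    where
    z≡u : z ≡ u
    z≡u with from (meet z) (inj₁ refl) | to (meet u) (inj₁ refl , inj₂ uv)
    ... | inj₁ z≡u , _ | _        = z≡u
    ... | inj₂ _ , _   | inj₁ u≡z = sym u≡z
    ... | inj₂ zu , _  | inj₂ uz  = contradiction uz (noSym z u zu)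

  finSourcePath-source⊎parent : ∀ {v} → FinSourcePath D v → Source v ⊎ ∃ λ u → Parent u v
  finSourcePath-source⊎parent {v} record { len = zero ; vtx = x ; ends = x₀≡v ; vset = vset } =
    inj₁ λ w vw → only-x₀ (to (vset w) vw)
    where
    only-x₀ : ∀ {w} → ∃ (λ (i : Fin 1) → x i ≡ w) → w ≡ v
    only-x₀ (F.zero , e) = trans (sym e) x₀≡v
  finSourcePath-source⊎parent {v} record { len = suc _ ; vtx = x ; ends = x₀≡v ; vset = vset ; arcs = arcs } =
    inj₂ (x₁ , x₁⇒v , ancestor)
    where
    x₁ : V
    x₁ = x (F.suc F.zero)
    x₁⇒v : x₁ ⇒ v
    x₁⇒v = subst (x₁ ⇒_) x₀≡v (from (arcs (F.suc F.zero) F.zero) (s≤s z≤n))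
    ancestor : ∀ w → B v w → w ≢ v → B x₁ w
    ancestor w vw w≢v with to (vset w) vw
    ... | F.zero , e             = contradiction (trans (sym e) x₀≡v) w≢v
    ... | F.suc F.zero , e       = inj₁ (sym e)
    ... | F.suc (F.suc i) , refl = inj₂ (from (arcs (F.suc (F.suc i)) (F.suc F.zero)) (s≤s (s≤s z≤n)))

  infSourcePath-parent : ∀ {v} → InfSourcePath D v → ∃ λ u → Parent u v
  infSourcePath-parent {v} record { vtx = x ; ends = x₀≡v ; vset = vset ; arcs = arcs } =
    x 1 , x₁⇒v , ancestor
    where
    x₁⇒v : x 1 ⇒ v
    x₁⇒v = subst (x 1 ⇒_) x₀≡v (from (arcs 1 0) (s≤s z≤n))
    ancestor : ∀ w → B v w → w ≢ v → B (x 1) w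
    ancestor w vw w≢v with to (vset w) vw
    ... | zero , e           = contradiction (trans (sym e) x₀≡v) w≢v
    ... | suc zero , e       = inj₁ (sym e)
    ... | suc (suc i) , refl = inj₂ (from (arcs (suc (suc i)) 1) (s≤s (s≤s z≤n)))

  V-isIdentifyingCode : IsIdentifyingCode D (λ _ → true)
  V-isIdentifyingCode = (λ u → u , inj₁ refl , refl) , separates
    where
    separates : ∀ u v → u ≢ v → ¬ (∀ w → (B u w × true ≡ true) ⇔ (B v w × true ≡ true))
    separates u v u≢v same
      with proj₁ (to (same u) (inj₁ refl , refl)) | proj₁ (from (same v) (inj₁ refl , refl))
    ... | inj₁ u≡v | _        = u≢v u≡v
    ... | inj₂ _   | inj₁ v≡u = u≢v (sym v≡u)
    ... | inj₂ uv  | inj₂ vu  = noSym u v uv vu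

  module _ {C : V → Bool} (code : IsIdentifyingCode D C) where

    source∈code : ∀ {v} → Source v → C v ≡ true
    source∈code {v} source with proj₁ code v
    ... | w , vw , w∈C = subst (λ t → C t ≡ true) (source w vw) w∈C

    parent⇒∈code : ∀ {u v} → Parent u v → (∀ w → B u w → B v w) → C v ≡ true
    parent⇒∈code {u} {v} (uv , ancestor) u⊆v with C v in v∉C
    ... | true  = refl
    ... | false = ⊥-elim (proj₂ code u v (arc⇒≢ uv) λ w → mk⇔
      (λ (uw , w∈C) → u⊆v w uw , w∈C)
      λ { (inj₁ refl , v∈C) → contradiction (trans (sym v∈C) v∉C) λ ()
        ; (inj₂ wv , w∈C)   → ancestor w (inj₂ wv) (arc⇒≢ wv) , w∈C })

    everyVertex∈code : BallsClosedUnderMeet → (∀ v → Source v ⊎ ∃ λ u → Parent u v) →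
      ∀ v → C v ≡ true
    everyVertex∈code meets source⊎parent v with source⊎parent v
    ... | inj₁ source                = source∈code source
    ... | inj₂ (u , parent@(uv , _)) = parent⇒∈code parent (arc⇒ball-⊆ meets uv)

proposition5 : (D : OrientedGraph) → SourceTransitiveTree D →
    IsIdentifyingCode D (λ _ → true)
    × ((C : OrientedGraph.V D → Bool) → IsIdentifyingCode D C →
       ∀ v → C v ≡ true)
proposition5 D (inj₁ T) = V-isIdentifyingCode D , λ C code →
  everyVertex∈code D code
    (ballsClosedUnderMeet-transport D _ (λ x → FinSourcePath.vset (path x)) meet)
    (λ v → finSourcePath-source⊎parent D (path v))
  where open FstTree T
proposition5 D (inj₂ T) = V-isIdentifyingCode D , λ C code →
  everyVertex∈code D code
    (ballsClosedUnderMeet-transport D _ (λ x → InfSourcePath.vset (path x)) meet)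
    (λ v → inj₂ (infSourcePath-parent D (path v)))
  where open IstTree T
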